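{- Let $T_3=\{12,1\overline{2},21\}$. Then $b_n(T_3\cup\{\overline{1}\,\overline{2}\})=1+\binom{n+1}{2}$ for every $n\ge 0$.
   Context: A signed permutation of length $n$ is a word $\alpha=\alpha_1\cdots\alpha_n$ in which each of the symbols $1,\dots,n$ appears exactly once, each occurrence possibly barred (written $\overline{i}$). The set of all of them is $B_n$, and $B_0$ consists of the empty word. For a symbol $x$, $|x|$ denotes the underlying number with any bar removed. For $\tau=\tau_1\cdots\tau_k\in B_k$ and $\alpha\in B_n$, $\alpha$ contains $\tau$ if there are indices $1\le i_1<\cdots<i_k\le n$ such that (1) $|\alpha_{i_p}|>|\alpha_{i_q}|$ if and only if $|\tau_p|>|\tau_q|$ for all $p,q$, and (2) $\alpha_{i_j}$ is barred if and only if $\tau_j$ is barred for every $j$. Otherwise $\alpha$ avoids $\tau$. $B_n(T)$ is the set of $\alpha\in B_n$ avoiding every pattern in $T$, and $b_n(T)=|B_n(T)|$. -}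

module Defs where

open import Data.Nat using (ℕ)
open import Data.Bool using (Bool; true; false)
open import Data.Fin using (Fin; zero; suc; _<_; _>_)
open import Data.Vec using (Vec; lookup; []; _∷_)
open import Data.Product using (Σ; _×_; _,_; proj₁; proj₂; ∃)
open import Data.List using (List; []; _∷_)
open import Data.List.Relation.Unary.All using (All)
open import Function.Definitions using (Injective)
open import Function.Bundles using (_⇔_)
open import Relation.Binary.PropositionalEquality using (_≡_)
open import Relation.Nullary using (¬_)

-- A (signed) word of length n: the j-th letter is (barred?, value), where the
-- value  v : Fin n  stands for the symbol v+1 ∈ {1,…,n}; barred? = true means
-- the letter is barred.
Word : ℕ → Set
Word n = Vec (Bool × Fin n) n

barAt : ∀ {n} → Word n → Fin n → Bool
barAt w i = proj₁ (lookup w i)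

absAt : ∀ {n} → Word n → Fin n → Fin n
absAt w i = proj₂ (lookup w i)

-- A word is a signed permutation iff every symbol 1..n occurs exactly once,
-- i.e. the map position ↦ |letter| is injective (hence bijective on Fin n).
IsSignedPerm : ∀ {n} → Word n → Set
IsSignedPerm w = Injective _≡_ _≡_ (absAt w)

SignedPerm : ℕ → Set
SignedPerm n = Σ (Word n) IsSignedPerm

Pattern : Set
Pattern = Σ ℕ SignedPerm

Contains : ∀ {n} → Pattern → Word n → Set
Contains {n} (k , τ , _) α =
  Σ (Fin k → Fin n) λ ι →
    (∀ p q → p < q → ι p < ι q) ×
    (∀ p q → (absAt α (ι p) > absAt α (ι q)) ⇔ (absAt τ p > absAt τ q)) ×
    (∀ j → barAt α (ι j) ≡ barAt τ j)

Avoids : ∀ {n} → List Pattern → Word n → Set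
Avoids T α = All (λ τ → ¬ Contains τ α) T

InB : ∀ n → List Pattern → Word n → Set
InB n T α = IsSignedPerm α × Avoids T α

HasCount : ∀ n → List Pattern → ℕ → Set
HasCount n T m =
  Σ (Fin m → Word n) λ f →
    Injective _≡_ _≡_ f ×
    (∀ i → InB n T (f i)) ×
    (∀ α → InB n T α → ∃ λ i → f i ≡ α)

open import Relation.Binary.PropositionalEquality using (refl)

p12 : Pattern
p12 = 2 , ((false , zero) ∷ (false , suc zero) ∷ []) , λ { {zero} {zero} _ → refl ; {suc zero} {suc zero} _ → refl ; {zero} {suc zero} () ; {suc zero} {zero} () }

p12b : Pattern
p12b = 2 , ((false , zero) ∷ (true , suc zero) ∷ []) , λ { {zero} {zero} _ → refl ; {suc zero} {suc zero} _ → refl ; {zero} {suc zero} () ; {suc zero} {zero} () }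

p21 : Pattern
p21 = 2 , ((false , suc zero) ∷ (false , zero) ∷ []) , λ { {zero} {zero} _ → refl ; {suc zero} {suc zero} _ → refl ; {zero} {suc zero} () ; {suc zero} {zero} () }

p1b2b : Pattern
p1b2b = 2 , ((true , zero) ∷ (true , suc zero) ∷ []) , λ { {zero} {zero} _ → refl ; {suc zero} {suc zero} _ → refl ; {zero} {suc zero} () ; {suc zero} {zero} () }

T3 : List Pattern
T3 = p12 ∷ p12b ∷ p21 ∷ []

{-# OPTIONS --safe #-}
module Submission where

-- A signed permutation avoids T₄ = {12, 1 2̄, 21, 1̄ 2̄} iff every pair of letters x … y in it
-- satisfies MayPrecede x y: 12 and 21 forbid two unbarred letters, and 1 2̄, 1̄ 2̄ forbid a
-- barred letter larger than an earlier one. Look at where the largest symbol n+1 sits in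
-- such a word. If it is barred it must come first, and deleting it leaves an arbitrary
-- avoider of length n. If it is unbarred, every other letter is barred, so they decrease
-- and form n̄ ⋯ 1̄, and n+1 can be at any of the n+1 positions. Hence b₀ = 1 and
-- b_{n+1} = b_n + (n+1), which adds up to 1 + (n+1 choose 2).

open import Defs
open import Data.Nat as ℕ using (ℕ; zero; suc; _+_; s≤s; z<s)
import Data.Nat.Properties as ℕ
open import Data.Nat.Combinatorics using (_C_; nC1≡n; nCk+nC[k+1]≡[n+1]C[k+1])
open import Data.Bool using (Bool; true; false)
open import Data.Empty using (⊥; ⊥-elim)
open import Data.Fin
  using (Fin; zero; suc; _<_; _>_; toℕ; fromℕ; inject₁; lower₁; punchIn; punchOut; splitAt; join; _≟_)
open import Data.Fin.Properties
  using ( <-cmp; <-asym; <⇒≢; ≤-antisym; ≤fromℕ; toℕ-fromℕ; toℕ-inject₁; toℕ-injective; inject₁ℕ<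
        ; inject₁-injective; inject₁-lower₁; fromℕ≢inject₁; punchIn-injective; punchInᵢ≢i
        ; punchIn-mono-≤; punchIn-cancel-≤; punchIn-punchOut; injective⇒existsPivot; splitAt-join; +↔⊎ )
open import Data.List using (List; _∷ʳ_)
open import Data.List.Relation.Unary.All using ([]; _∷_)
open import Data.Product using (_×_; _,_; proj₁; proj₂; ∃; ∃-syntax)
open import Data.Sum using (_⊎_; inj₁; inj₂; [_,_]′; swap)
open import Data.Unit using (⊤; tt)
open import Data.Vec using ([]; _∷_; lookup; map; tabulate; insertAt)
open import Data.Vec.Properties using (insertAt-lookup; insertAt-punchIn; lookup-map; lookup∘tabulate)
open import Data.Vec.Relation.Binary.Pointwise.Extensional using (ext; Pointwise-≡⇒≡)
open import Function using (_∘_)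
open import Function.Bundles using (_⇔_; mk⇔; Equivalence; Injection)
open import Function.Definitions using (Injective)
open import Function.Properties.Equivalence using () renaming (sym to ⇔-sym)
open import Function.Properties.Inverse using (↔⇒↣)
open import Relation.Binary.Definitions using (tri<; tri≈; tri>)
open import Relation.Binary.PropositionalEquality
open import Relation.Nullary using (¬_; yes; no; contradiction)

T₄ : List Pattern
T₄ = T3 ∷ʳ p1b2b

Letter : ℕ → Set
Letter n = Bool × Fin n

MayPrecede : ∀ {n} → Letter n → Letter n → Set
MayPrecede (_     , v) (true  , w) = w < v
MayPrecede (true  , _) (false , _) = ⊤
MayPrecede (false , _) (false , _) = ⊥

Admissible : ∀ {n} → Word n → Set
Admissible α = ∀ {i j} → i < j → MayPrecede (lookup α i) (lookup α j)

Valid : ∀ {n} → Word n → Set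
Valid α = IsSignedPerm α × Admissible α

mayPrecede-transfer : ∀ {m n} b c {v w : Fin m} {v′ w′ : Fin n} →
                      (w < v ⇔ w′ < v′) → MayPrecede (b , v) (c , w) → MayPrecede (b , v′) (c , w′)
mayPrecede-transfer b     true  w<v⇔w′<v′ = Equivalence.to w<v⇔w′<v′
mayPrecede-transfer true  false _         = λ _ → tt
mayPrecede-transfer false false _         = λ ()

OrderedAlike : ∀ {m n} → Fin m → Fin m → Fin n → Fin n → Set
OrderedAlike x y u v = (x < y × u < v) ⊎ (y < x × v < u)

orderedAlike⇒>⇔> : ∀ {m n} {x y : Fin m} {u v : Fin n} → OrderedAlike x y u v → (x > y ⇔ u > v)
orderedAlike⇒>⇔> (inj₁ (x<y , u<v)) =
  mk⇔ (λ y<x → contradiction x<y (<-asym y<x)) (λ v<u → contradiction u<v (<-asym v<u))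
orderedAlike⇒>⇔> (inj₂ (y<x , v<u)) = mk⇔ (λ _ → v<u) (λ _ → y<x)

>-irrefl-⇔ : ∀ {m n} {x : Fin m} {u : Fin n} → (x > x ⇔ u > u)
>-irrefl-⇔ = mk⇔ (contradiction refl ∘ <⇒≢) (contradiction refl ∘ <⇒≢)

contains-pair : ∀ {n} {α : Word n} {i j} {v w : Fin n} ((τ , τ-perm) : SignedPerm 2) → i < j →
                lookup α i ≡ (barAt τ zero , v) → lookup α j ≡ (barAt τ (suc zero) , w) →
                OrderedAlike v w (absAt τ zero) (absAt τ (suc zero)) → Contains (2 , τ , τ-perm) α
contains-pair {n} {α} {i} {j} (τ , _) i<j αᵢ αⱼ v,w-alike = ι , increasing , order , bars
  where
  ι : Fin 2 → Fin n
  ι = lookup (i ∷ j ∷ [])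
  alike : OrderedAlike (absAt α i) (absAt α j) (absAt τ zero) (absAt τ (suc zero))
  alike = subst₂ (λ x y → OrderedAlike x y _ _) (sym (cong proj₂ αᵢ)) (sym (cong proj₂ αⱼ)) v,w-alike
  increasing : ∀ p q → p < q → ι p < ι q
  increasing zero       (suc zero) _ = i<j
  increasing (suc zero) (suc zero) (s≤s ())
  order : ∀ p q → (absAt α (ι p) > absAt α (ι q)) ⇔ (absAt τ p > absAt τ q)
  order zero       zero       = >-irrefl-⇔
  order zero       (suc zero) = orderedAlike⇒>⇔> alike
  order (suc zero) zero       = orderedAlike⇒>⇔> (swap alike)
  order (suc zero) (suc zero) = >-irrefl-⇔
  bars : ∀ p → barAt α (ι p) ≡ barAt τ p
  bars zero       = cong proj₁ αᵢ
  bars (suc zero) = cong proj₁ αⱼ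

admissible⇒avoids-pair : ∀ {n} {α : Word n} ((τ , τ-perm) : SignedPerm 2) → Admissible α →
                         ¬ MayPrecede (lookup τ zero) (lookup τ (suc zero)) → ¬ Contains (2 , τ , τ-perm) α
admissible⇒avoids-pair {α = α} (τ , _) α-adm τ-forbidden (ι , ι-increasing , ι-order , ι-bars) =
  τ-forbidden (mayPrecede-transfer (barAt τ zero) (barAt τ (suc zero)) (ι-order zero (suc zero))
    (subst₂ (λ b c → MayPrecede (b , absAt α (ι zero)) (c , absAt α (ι (suc zero))))
      (ι-bars zero) (ι-bars (suc zero)) (α-adm (ι-increasing zero (suc zero) z<s))))

admissible⇒avoids : ∀ {n} {α : Word n} → Admissible α → Avoids T₄ α
admissible⇒avoids {α = α} α-adm =
  avoids (proj₂ p12) (λ ()) ∷ avoids (proj₂ p12b) (λ ()) ∷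
  avoids (proj₂ p21) (λ ()) ∷ avoids (proj₂ p1b2b) (λ ()) ∷ []
  where
  avoids : ((τ , τ-perm) : SignedPerm 2) → ¬ MayPrecede (lookup τ zero) (lookup τ (suc zero)) →
           ¬ Contains (2 , τ , τ-perm) α
  avoids τ = admissible⇒avoids-pair {α = α} τ α-adm

avoids⇒admissible : ∀ {n} {α : Word n} → IsSignedPerm α → Avoids T₄ α → Admissible α
avoids⇒admissible {α = α} α-perm (¬12 ∷ ¬12̄ ∷ ¬21 ∷ ¬1̄2̄ ∷ []) {i} {j} i<j
  with lookup α i in αᵢ | lookup α j in αⱼ
... | bᵢ , vᵢ | bⱼ , vⱼ with bᵢ | bⱼ | <-cmp vᵢ vⱼ
...   | _     | _     | tri≈ _ vᵢ≡vⱼ _ =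
  contradiction (α-perm (trans (cong proj₂ αᵢ) (trans vᵢ≡vⱼ (sym (cong proj₂ αⱼ))))) (<⇒≢ i<j)
...   | false | false | tri< vᵢ<vⱼ _ _ =
  ⊥-elim (¬12 (contains-pair {α = α} (proj₂ p12) i<j αᵢ αⱼ (inj₁ (vᵢ<vⱼ , z<s))))
...   | false | false | tri> _ _ vᵢ>vⱼ =
  ⊥-elim (¬21 (contains-pair {α = α} (proj₂ p21) i<j αᵢ αⱼ (inj₂ (vᵢ>vⱼ , z<s))))
...   | false | true  | tri< vᵢ<vⱼ _ _ =
  ⊥-elim (¬12̄ (contains-pair {α = α} (proj₂ p12b) i<j αᵢ αⱼ (inj₁ (vᵢ<vⱼ , z<s))))
...   | true  | true  | tri< vᵢ<vⱼ _ _ =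
  ⊥-elim (¬1̄2̄ (contains-pair {α = α} (proj₂ p1b2b) i<j αᵢ αⱼ (inj₁ (vᵢ<vⱼ , z<s))))
...   | false | true  | tri> _ _ vᵢ>vⱼ = vᵢ>vⱼ
...   | true  | true  | tri> _ _ vᵢ>vⱼ = vᵢ>vⱼ
...   | true  | false | _              = tt

inB⇔valid : ∀ {n} (α : Word n) → InB n T₄ α ⇔ Valid α
inB⇔valid α = mk⇔ (λ (α-perm , α-avoids) → α-perm , avoids⇒admissible {α = α} α-perm α-avoids)
                  (λ (α-perm , α-adm) → α-perm , admissible⇒avoids {α = α} α-adm)

data InsertView {n} (k : Fin (suc n)) : Fin (suc n) → Set where
  inserted : InsertView k k
  kept     : ∀ j → InsertView k (punchIn k j)

insertView : ∀ {n} (k i : Fin (suc n)) → InsertView k i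
insertView k i with k ≟ i
... | yes refl = inserted
... | no k≢i   = subst (InsertView k) (punchIn-punchOut k≢i) (kept (punchOut k≢i))

punchIn-mono-< : ∀ {n} (k : Fin (suc n)) {i j : Fin n} → i < j → punchIn k i < punchIn k j
punchIn-mono-< k {i} {j} i<j = ℕ.≰⇒> (ℕ.<⇒≱ i<j ∘ punchIn-cancel-≤ k j i)

punchIn-cancel-< : ∀ {n} (k : Fin (suc n)) {i j : Fin n} → punchIn k i < punchIn k j → i < j
punchIn-cancel-< k {i} {j} ↑i<↑j = ℕ.≰⇒> (ℕ.<⇒≱ ↑i<↑j ∘ punchIn-mono-≤ k j i)

inject₁<fromℕ : ∀ {n} (v : Fin n) → inject₁ v < fromℕ n
inject₁<fromℕ {n} v = subst (toℕ (inject₁ v) ℕ.<_) (sym (toℕ-fromℕ n)) (inject₁ℕ< v)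

inject₁-<⇔ : ∀ {n} {v w : Fin n} → (v < w ⇔ inject₁ v < inject₁ w)
inject₁-<⇔ {v = v} {w} = mk⇔ (subst₂ ℕ._<_ (sym (toℕ-inject₁ v)) (sym (toℕ-inject₁ w)))
                             (subst₂ ℕ._<_ (toℕ-inject₁ v) (toℕ-inject₁ w))

liftLetter : ∀ {n} → Letter n → Letter (suc n)
liftLetter (b , v) = b , inject₁ v

liftLetter-injective : ∀ {n} → Injective _≡_ _≡_ (liftLetter {n})
liftLetter-injective eq = cong₂ _,_ (cong proj₁ eq) (inject₁-injective (cong proj₂ eq))

liftLetter-mayPrecede : ∀ {n} (x y : Letter n) → MayPrecede x y ⇔ MayPrecede (liftLetter x) (liftLetter y)
liftLetter-mayPrecede (b , v) (c , w) =
  mk⇔ (mayPrecede-transfer b c inject₁-<⇔) (mayPrecede-transfer b c (⇔-sym inject₁-<⇔))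

barredMax-mayPrecede : ∀ {n} (x : Letter n) → MayPrecede (true , fromℕ n) (liftLetter x)
barredMax-mayPrecede (true  , v) = inject₁<fromℕ v
barredMax-mayPrecede (false , _) = tt

¬mayPrecede-barredMax : ∀ {n} (x : Letter n) → ¬ MayPrecede (liftLetter x) (true , fromℕ n)
¬mayPrecede-barredMax (_ , v) max<v = ℕ.<⇒≱ max<v (≤fromℕ (inject₁ v))

barred-mayPrecede-unbarred : ∀ {n} (x : Letter n) {w} → proj₁ x ≡ true → MayPrecede (liftLetter x) (false , w)
barred-mayPrecede-unbarred (true , _) _ = tt

max-mayPrecede-barred : ∀ {n} (x : Letter n) {b} → proj₁ x ≡ true → MayPrecede (b , fromℕ n) (liftLetter x)
max-mayPrecede-barred (true , v) _ = inject₁<fromℕ v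

mayPrecede-unbarred⇒barred : ∀ {n} (x : Letter n) {w} → MayPrecede x (false , w) → proj₁ x ≡ true
mayPrecede-unbarred⇒barred (true , _) _ = refl

unbarred-mayPrecede⇒barred : ∀ {n} (y : Letter n) {v} → MayPrecede (false , v) y → proj₁ y ≡ true
unbarred-mayPrecede⇒barred (true , _) _ = refl

-- Opaque so that unification can recover b, k and a from withMax b k a; the two lookup
-- laws below are all that is used of its definition.
opaque
  withMax : ∀ {n} → Bool → Fin (suc n) → Word n → Word (suc n)
  withMax {n} b k a = insertAt (map liftLetter a) k (b , fromℕ n)

  lookup-withMax-inserted : ∀ {n b k} {a : Word n} → lookup (withMax b k a) k ≡ (b , fromℕ n)
  lookup-withMax-inserted {n} {b} {k} {a} = insertAt-lookup (map liftLetter a) k (b , fromℕ n)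

  lookup-withMax-kept : ∀ {n b k} {a : Word n} j → lookup (withMax b k a) (punchIn k j) ≡ liftLetter (lookup a j)
  lookup-withMax-kept {n} {b} {k} {a} j =
    trans (insertAt-punchIn (map liftLetter a) k (b , fromℕ n) j) (lookup-map j liftLetter a)

descending : ∀ n → Word n
descending zero    = []
descending (suc n) = withMax true zero (descending n)

AllBarred : ∀ {n} → Word n → Set
AllBarred a = ∀ j → barAt a j ≡ true

module _ {n} {b : Bool} {k : Fin (suc n)} {a : Word n} where

  absAt-withMax-inserted : absAt (withMax b k a) k ≡ fromℕ n
  absAt-withMax-inserted = cong proj₂ lookup-withMax-inserted

  absAt-withMax-kept : ∀ j → absAt (withMax b k a) (punchIn k j) ≡ inject₁ (absAt a j)
  absAt-withMax-kept j = cong proj₂ (lookup-withMax-kept j)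

  withMax-signedPerm : IsSignedPerm a → IsSignedPerm (withMax b k a)
  withMax-signedPerm a-perm {i} {j} eq with insertView k i | insertView k j
  ... | inserted | inserted = refl
  ... | inserted | kept j′  = contradiction
    (trans (sym absAt-withMax-inserted) (trans eq (absAt-withMax-kept j′))) fromℕ≢inject₁
  ... | kept i′  | inserted = contradiction
    (trans (sym absAt-withMax-inserted) (trans (sym eq) (absAt-withMax-kept i′))) fromℕ≢inject₁
  ... | kept i′  | kept j′  = cong (punchIn k) (a-perm (inject₁-injective
    (trans (sym (absAt-withMax-kept i′)) (trans eq (absAt-withMax-kept j′)))))

  withMax-signedPerm⁻ : IsSignedPerm (withMax b k a) → IsSignedPerm a
  withMax-signedPerm⁻ perm {i} {j} eq = punchIn-injective k i j
    (perm (trans (absAt-withMax-kept i) (trans (cong inject₁ eq) (sym (absAt-withMax-kept j)))))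

  withMax-admissible : Admissible a →
                       (∀ {j} → punchIn k j < k → MayPrecede (liftLetter (lookup a j)) (b , fromℕ n)) →
                       (∀ {j} → k < punchIn k j → MayPrecede (b , fromℕ n) (liftLetter (lookup a j))) →
                       Admissible (withMax b k a)
  withMax-admissible a-adm before after {i} {j} i<j with insertView k i | insertView k j
  ... | inserted | inserted = contradiction refl (<⇒≢ i<j)
  ... | inserted | kept j′  =
    subst₂ MayPrecede (sym lookup-withMax-inserted) (sym (lookup-withMax-kept j′)) (after i<j)
  ... | kept i′  | inserted =
    subst₂ MayPrecede (sym (lookup-withMax-kept i′)) (sym lookup-withMax-inserted) (before i<j)
  ... | kept i′  | kept j′  =
    subst₂ MayPrecede (sym (lookup-withMax-kept i′)) (sym (lookup-withMax-kept j′))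
      (Equivalence.to (liftLetter-mayPrecede _ _) (a-adm (punchIn-cancel-< k i<j)))

  withMax-admissible⁻ : Admissible (withMax b k a) → Admissible a
  withMax-admissible⁻ adm {i} {j} i<j = Equivalence.from (liftLetter-mayPrecede _ _)
    (subst₂ MayPrecede (lookup-withMax-kept i) (lookup-withMax-kept j) (adm (punchIn-mono-< k i<j)))

  withMax-admissible⇒before : Admissible (withMax b k a) →
                              ∀ {j} → punchIn k j < k → MayPrecede (liftLetter (lookup a j)) (b , fromℕ n)
  withMax-admissible⇒before adm {j} ↑j<k =
    subst₂ MayPrecede (lookup-withMax-kept j) lookup-withMax-inserted (adm ↑j<k)

  withMax-admissible⇒after : Admissible (withMax b k a) →
                             ∀ {j} → k < punchIn k j → MayPrecede (b , fromℕ n) (liftLetter (lookup a j))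
  withMax-admissible⇒after adm {j} k<↑j =
    subst₂ MayPrecede lookup-withMax-inserted (lookup-withMax-kept j) (adm k<↑j)

  withMax-valid⁻ : Valid (withMax b k a) → Valid a
  withMax-valid⁻ (perm , adm) = withMax-signedPerm⁻ perm , withMax-admissible⁻ adm

  withMax-allBarred⁻ : AllBarred (withMax b k a) → AllBarred a
  withMax-allBarred⁻ barred j = trans (cong proj₁ (sym (lookup-withMax-kept j))) (barred (punchIn k j))

withMax-injective : ∀ {n} {b b′ k k′} {a a′ : Word n} →
                    withMax b k a ≡ withMax b′ k′ a′ → b ≡ b′ × k ≡ k′ × a ≡ a′
withMax-injective {k = k} {k′} eq with insertView k′ k
... | kept j   = contradiction
  (cong proj₂ (trans (sym lookup-withMax-inserted)
                     (trans (cong (λ w → lookup w k) eq) (lookup-withMax-kept j))))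
  fromℕ≢inject₁
... | inserted =
  cong proj₁ (trans (sym lookup-withMax-inserted)
                    (trans (cong (λ w → lookup w k) eq) lookup-withMax-inserted)) ,
  refl ,
  Pointwise-≡⇒≡ (ext λ j → liftLetter-injective
    (trans (sym (lookup-withMax-kept j))
           (trans (cong (λ w → lookup w (punchIn k j)) eq) (lookup-withMax-kept j))))

barredMax-valid : ∀ {n} {a : Word n} → Valid a → Valid (withMax true zero a)
barredMax-valid {a = a} (a-perm , a-adm) =
  withMax-signedPerm a-perm ,
  withMax-admissible a-adm (λ ()) (λ {j} _ → barredMax-mayPrecede (lookup a j))

unbarredMax-valid : ∀ {n} {k : Fin (suc n)} {a : Word n} → AllBarred a → Valid a → Valid (withMax false k a)
unbarredMax-valid {a = a} a-barred (a-perm , a-adm) =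
  withMax-signedPerm a-perm ,
  withMax-admissible a-adm (λ {j} _ → barred-mayPrecede-unbarred (lookup a j) (a-barred j))
                           (λ {j} _ → max-mayPrecede-barred (lookup a j) (a-barred j))

descending-valid : ∀ n → Valid (descending n)
descending-valid zero    = (λ { {()} }) , λ { {()} }
descending-valid (suc n) = barredMax-valid (descending-valid n)

descending-allBarred : ∀ n → AllBarred (descending n)
descending-allBarred (suc n) zero    = cong proj₁ lookup-withMax-inserted
descending-allBarred (suc n) (suc j) =
  trans (cong proj₁ (lookup-withMax-kept j)) (descending-allBarred n j)

barredMax-first : ∀ {n} {k : Fin (suc n)} {a : Word n} → Admissible (withMax true k a) → k ≡ zero
barredMax-first {k = zero}          _   = refl
barredMax-first {suc n} {suc k} {a} adm =
  contradiction (withMax-admissible⇒before adm {zero} z<s) (¬mayPrecede-barredMax (lookup a zero))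

unbarredMax-others-barred : ∀ {n} {k : Fin (suc n)} {a : Word n} → Admissible (withMax false k a) → AllBarred a
unbarredMax-others-barred {k = k} adm j with <-cmp (punchIn k j) k
... | tri< ↑j<k _ _ = mayPrecede-unbarred⇒barred _ (withMax-admissible⇒before adm ↑j<k)
... | tri≈ _ ↑j≡k _ = contradiction ↑j≡k (punchInᵢ≢i k j)
... | tri> _ _ k<↑j = unbarred-mayPrecede⇒barred _ (withMax-admissible⇒after adm k<↑j)

signedPerm-decomposition : ∀ {n} (α : Word (suc n)) → IsSignedPerm α → ∃[ b ] ∃[ k ] ∃[ a ] α ≡ withMax b k a
signedPerm-decomposition {n} α α-perm = barAt α k , k , a , Pointwise-≡⇒≡ (ext agree)
  where
  maxPosition : ∃ λ k → absAt α k ≡ fromℕ n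
  maxPosition with k , _ , max≤αₖ ← injective⇒existsPivot α-perm (fromℕ n) = k , ≤-antisym (≤fromℕ _) max≤αₖ
  k : Fin (suc n)
  k = proj₁ maxPosition
  others-below : ∀ j → n ≢ toℕ (absAt α (punchIn k j))
  others-below j n≡αⱼ = punchInᵢ≢i k j (α-perm (toℕ-injective
    (trans (sym n≡αⱼ) (trans (sym (toℕ-fromℕ n)) (cong toℕ (sym (proj₂ maxPosition)))))))
  a : Word n
  a = tabulate λ j → barAt α (punchIn k j) , lower₁ (absAt α (punchIn k j)) (others-below j)
  agree : ∀ i → lookup α i ≡ lookup (withMax (barAt α k) k a) i
  agree i with insertView k i
  ... | inserted = trans (cong (barAt α k ,_) (proj₂ maxPosition)) (sym lookup-withMax-inserted)
  ... | kept j   = trans (cong (barAt α (punchIn k j) ,_) (sym (inject₁-lower₁ _ (others-below j))))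
                         (sym (trans (lookup-withMax-kept j) (cong liftLetter (lookup∘tabulate _ j))))

allBarred-valid⇒descending : ∀ {n} {a : Word n} → AllBarred a → Valid a → a ≡ descending n
allBarred-valid⇒descending {zero} {[]} _ _ = refl
allBarred-valid⇒descending {suc n} {a} a-barred (a-perm , a-adm) with signedPerm-decomposition a a-perm
... | b , k , a′ , refl with trans (sym (cong proj₁ lookup-withMax-inserted)) (a-barred k)
...   | refl with barredMax-first a-adm
...     | refl = cong (withMax true zero)
                   (allBarred-valid⇒descending (withMax-allBarred⁻ a-barred)
                                               (withMax-valid⁻ (a-perm , a-adm)))

valid-classification : ∀ {n} {α : Word (suc n)} → Valid α →
                       (∃[ a ] Valid a × α ≡ withMax true zero a) ⊎ (∃[ k ] α ≡ withMax false k (descending n))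
valid-classification {α = α} (α-perm , α-adm) with signedPerm-decomposition α α-perm
... | false , k , a , refl = inj₂ (k , cong (withMax false k)
  (allBarred-valid⇒descending (unbarredMax-others-barred α-adm)
                              (withMax-valid⁻ (α-perm , α-adm))))
... | true  , k , a , refl with barredMax-first α-adm
...   | refl = inj₁ (a , withMax-valid⁻ (α-perm , α-adm) , refl)

hasCount-suc : ∀ {n m} → HasCount n T₄ m → HasCount (suc n) T₄ (m + suc n)
hasCount-suc {n} {m} (f , f-injective , f-inB , f-onto) =
  listing ∘ splitAt m ,
  splitAt-injective ∘ listing-injective ,
  (λ i → Equivalence.from (inB⇔valid (listing (splitAt m i))) (listing-valid (splitAt m i))) ,
  λ α α-inB → let s , listing-s≡α = listing-onto (Equivalence.to (inB⇔valid α) α-inB)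
              in join m (suc n) s , trans (cong listing (splitAt-join m (suc n) s)) listing-s≡α
  where
  splitAt-injective : Injective _≡_ _≡_ (splitAt m {suc n})
  splitAt-injective = Injection.injective (↔⇒↣ +↔⊎)

  listing : Fin m ⊎ Fin (suc n) → Word (suc n)
  listing = [ withMax true zero ∘ f , (λ k → withMax false k (descending n)) ]′

  listing-injective : Injective _≡_ _≡_ listing
  listing-injective {inj₁ i} {inj₁ j} eq =
    cong inj₁ (f-injective (proj₂ (proj₂ (withMax-injective eq))))
  listing-injective {inj₁ i} {inj₂ l} eq with () ← proj₁ (withMax-injective eq)
  listing-injective {inj₂ k} {inj₁ j} eq with () ← proj₁ (withMax-injective eq)
  listing-injective {inj₂ k} {inj₂ l} eq =
    cong inj₂ (proj₁ (proj₂ (withMax-injective eq)))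

  listing-valid : ∀ s → Valid (listing s)
  listing-valid (inj₁ i) = barredMax-valid (Equivalence.to (inB⇔valid (f i)) (f-inB i))
  listing-valid (inj₂ k) = unbarredMax-valid (descending-allBarred n) (descending-valid n)

  listing-onto : ∀ {α} → Valid α → ∃ λ s → listing s ≡ α
  listing-onto {α} α-valid with valid-classification {α = α} α-valid
  ... | inj₂ (k , refl)           = inj₂ k , refl
  ... | inj₁ (a , a-valid , refl) with f-onto a (Equivalence.from (inB⇔valid a) a-valid)
  ...   | i , refl = inj₁ i , refl

hasCount-zero : HasCount 0 T₄ 1
hasCount-zero = (λ _ → []) , (λ { {zero} {zero} _ → refl }) ,
                (λ _ → Equivalence.from (inB⇔valid []) (descending-valid 0)) , λ { [] _ → zero , refl }

1+[n+2]C2≡1+[n+1]C2+[n+1] : ∀ n → 1 + suc (suc n) C 2 ≡ (1 + suc n C 2) + suc n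
1+[n+2]C2≡1+[n+1]C2+[n+1] n = cong suc (begin
  suc (suc n) C 2        ≡⟨ nCk+nC[k+1]≡[n+1]C[k+1] (suc n) 1 ⟨
  suc n C 1 + suc n C 2  ≡⟨ cong (_+ suc n C 2) (nC1≡n (suc n)) ⟩
  suc n + suc n C 2      ≡⟨ ℕ.+-comm (suc n) (suc n C 2) ⟩
  suc n C 2 + suc n      ∎)
  where open ≡-Reasoning

mainTheorem4 : (n : ℕ) → HasCount n (T3 ∷ʳ p1b2b) (1 + (suc n) C 2)
mainTheorem4 zero    = hasCount-zero
mainTheorem4 (suc n) =
  subst (HasCount (suc n) T₄) (sym (1+[n+2]C2≡1+[n+1]C2+[n+1] n)) (hasCount-suc (mainTheorem4 n))
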